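{- For real $x$ let $[x]=\lfloor x+\tfrac12\rfloor$ (the nearest integer to $x$, rounded up when the fractional part is $\tfrac12$), and let $$f(x)=\sum_{j=0}^{\infty}\left[\frac{x}{2^{2j+1}}\right].$$ Let $(a_n,b_n)$, $n\ge1$, be the $P$-positions $(x,y)$ with $0<x\le y$ of Corner the Queen Bee, listed so that $a_1<a_2<\cdots$. Then $n=f(a_n)$ for every $n\ge1$.
   Context: Positions are pairs $(x,y)$ of nonnegative integers. From $(x,y)$ the Queen Bee may move to: (i) $(x',y)$ with $0\le x'<x$, or $(x,y')$ with $0\le y'<y$; (ii) $(x-s,y-s)$ with $1\le s\le\min(x,y)$; (iii) if $x<y$, to $(t,y-x)$ with $0<t<2x$; if $x>y$, to $(x-y,t)$ with $0<t<2y$. Every move strictly decreases $x+y$. $P$-positions: $(0,0)$ is a $P$-position, and a position is a $P$-position iff it has no move to a $P$-position. -}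

module Defs where

open import Data.Nat using (ℕ; zero; suc; _+_; _*_; _∸_; _^_; _<ᵇ_; _≤_; _<_; NonZero)
open import Data.Nat.DivMod using (_/_)
open import Data.Nat.Properties using (m^n≢0; m*n≢0)
open import Relation.Binary.PropositionalEquality using (_≡_)
open import Data.Bool using (Bool; true; false; not; if_then_else_)
open import Data.List using (List; []; _∷_; map; upTo; _++_)
open import Data.Nat.ListAction using (sum)
open import Data.Bool.ListAction using (any)
open import Data.Product using (_×_; _,_)

min : ℕ → ℕ → ℕ
min zero _ = zero
min (suc _) zero = zero
min (suc m) (suc n) = suc (min m n)

moves : ℕ → ℕ → List (ℕ × ℕ)
moves x y =
     map (λ x' → (x' , y)) (upTo x)
  ++ map (λ y' → (x , y')) (upTo y)
  ++ map (λ k → (x ∸ suc k , y ∸ suc k)) (upTo (min x y))   -- (ii) (x-s, y-s), 1 ≤ s ≤ min x y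
  ++ (if x <ᵇ y
        then map (λ k → (suc k , y ∸ x)) (upTo (2 * x ∸ 1)) -- (iii) x<y: (t, y-x), 0 < t < 2x
        else if y <ᵇ x
          then map (λ k → (x ∸ y , suc k)) (upTo (2 * y ∸ 1)) -- (iii) x>y: (x-y, t), 0 < t < 2y
          else [])

-- P-position test by recursion with fuel.  Every move strictly decreases
-- x + y, so fuel x + y suffices; with fuel 0 the only position reached is (0,0),
-- which has no moves and is a P-position.
isPFuel : ℕ → ℕ → ℕ → Bool
isPFuel zero x y = true
isPFuel (suc k) x y = not (any (λ { (x' , y') → isPFuel k x' y' }) (moves x y))

IsP : ℕ → ℕ → Set
IsP x y = isPFuel (x + y) x y ≡ true

-- Nearest integer [x / m] = ⌊ x/m + 1/2 ⌋ = ⌊ (2x + m) / (2m) ⌋ for naturals x, m > 0.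
nearestDiv : (x m : ℕ) → .{{NonZero m}} → ℕ
nearestDiv x m {{nz}} = (2 * x + m) / (2 * m)
  where
  instance
    nz2 : NonZero (2 * m)
    nz2 = m*n≢0 2 m

-- f(x) = Σ_{j ≥ 0} [ x / 2^(2j+1) ].  For j ≥ x we have 2^(2j+1) > 2x, so the
-- j-th term is 0; hence the infinite sum equals the finite sum over j = 0 .. x.
term : ℕ → ℕ → ℕ
term x j = nearestDiv x (2 ^ (2 * j + 1)) {{m^n≢0 2 (2 * j + 1)}}

f : ℕ → ℕ
f x = sum (map (term x) (upTo (suc x)))

-- The P-positions of Corner the Queen Bee are (0,0) together with the pairs {a, 2a} in which
-- the 2-adic valuation of a is even: this set admits no move inside itself, and every other
-- position has a move into it.  So a_n is the n-th positive integer of even 2-adic valuation.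
-- On the other side, [x / 2^(2j+3)] = [⌊x/4⌋ / 2^(2j+1)] gives f(x) = ⌊(x+1)/2⌋ + f(⌊x/4⌋):
-- f counts the odd numbers up to x and, recursively, the multiples of 4, so f(x+1) − f(x) is 1
-- exactly when x+1 has even 2-adic valuation.  A function counting a set takes the value n at
-- the n-th element of that set.
module Submission where

open import Defs
open import Data.Nat using (ℕ; zero; suc; _+_; _*_; _∸_; _^_; _≤_; _<_; _<ᵇ_; _⊓_; z≤n; s≤s; z<s; NonZero; _/_; _%_; _≟_)
open import Data.Nat.Properties
open import Data.Nat.DivMod
open import Data.Nat.Divisibility using (divides-refl)
open import Data.Nat.Induction using (<-wellFounded)
open import Data.Nat.ListAction using (sum)
open import Data.Nat.Tactic.RingSolver using (solve-∀)
open import Data.Bool using (Bool; true; false; not; T; if_then_else_)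
open import Data.Bool.ListAction using (any)
open import Data.Bool.Properties using (T-≡; T-not-≡)
open import Data.List using (List; []; map; upTo; applyUpTo; _++_)
open import Data.List.Properties using (map-upTo)
open import Data.List.Membership.Propositional using (_∈_; find; lose)
open import Data.List.Membership.Propositional.Properties using (∈-map⁺; ∈-map⁻; ∈-++⁺ˡ; ∈-++⁺ʳ; ∈-++⁻; ∈-upTo⁺; ∈-upTo⁻)
open import Data.List.Relation.Unary.Any.Properties using (any⁺; any⁻)
open import Data.Product using (_×_; _,_; proj₁; proj₂; ∃-syntax)
open import Data.Sum using (_⊎_; inj₁; inj₂)
open import Data.Unit using (tt)
open import Function.Bundles using (_⇔_; mk⇔; Equivalence)
open import Induction.WellFounded using (Acc; acc)
open import Relation.Nullary using (¬_; Dec; yes; no; contradiction)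
open import Relation.Nullary.Decidable using (_×-dec_; _⊎-dec_)
open import Relation.Binary.Definitions using (tri<; tri≈; tri>)
open import Relation.Binary.PropositionalEquality using (_≡_; _≢_; refl; sym; trans; cong; cong₂; subst; subst₂; module ≡-Reasoning)

-- Counting functions

CountStep : (ℕ → Set) → (ℕ → ℕ) → ℕ → Set
CountStep P g x = (P (suc x) → g (suc x) ≡ suc (g x)) × (¬ P (suc x) → g (suc x) ≡ g x)

record Counts (P : ℕ → Set) (g : ℕ → ℕ) : Set where
  field
    count-zero : g 0 ≡ 0
    count-step : ∀ x → CountStep P g x

module _ {P : ℕ → Set} {g : ℕ → ℕ} (counts : Counts P g) where
  open Counts counts

  count-constant : ∀ {x y} → x ≤ y → (∀ {i} → x < i → i ≤ y → ¬ P i) → g y ≡ g x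
  count-constant {y = zero} z≤n _ = refl
  count-constant {x} {suc y} x≤1+y gap with m≤n⇒m<n∨m≡n x≤1+y
  ... | inj₂ refl      = refl
  ... | inj₁ (s≤s x≤y) =
    trans (proj₂ (count-step y) (gap (s≤s x≤y) ≤-refl)) (count-constant x≤y (λ x<i i≤y → gap x<i (m≤n⇒m≤1+n i≤y)))

  count-jump : ∀ {x y} → x < y → (∀ {i} → x < i → i < y → ¬ P i) → P y → g y ≡ suc (g x)
  count-jump {x} {suc z} (s≤s x≤z) gap Py =
    trans (proj₁ (count-step z) Py) (cong suc (count-constant x≤z (λ x<i i≤z → gap x<i (s≤s i≤z))))

  count-enumeration : (a : ℕ → ℕ) → (∀ m n → 1 ≤ m → m < n → a m < a n) →
                      (∀ n → 1 ≤ n → P (a n)) → (∀ x → P x → ∃[ n ] (1 ≤ n × a n ≡ x)) → ¬ P 0 →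
                      ∀ n → 1 ≤ n → g (a n) ≡ n
  count-enumeration a a-mono a-P a-onto ¬P0 (suc n) _ = g-next n
    where
    a-reflect : ∀ {m n} → 1 ≤ n → a m < a n → m < n
    a-reflect {m} {n} 1≤n am<an with <-cmp m n
    ... | tri< m<n _ _  = m<n
    ... | tri≈ _ refl _ = contradiction am<an (<-irrefl refl)
    ... | tri> _ _ n<m  = contradiction am<an (<-asym (a-mono n m 1≤n n<m))
    P-below : ∀ {i m} → P i → i < a (suc m) → ∃[ k ] (1 ≤ k × k ≤ m × a k ≡ i)
    P-below {i} Pi i<a[m+1] with k , 1≤k , ak≡i ← a-onto i Pi =
      k , 1≤k , ≤-pred (a-reflect z<s (subst (_< _) (sym ak≡i) i<a[m+1])) , ak≡i
    g-next : ∀ n → g (a (suc n)) ≡ suc n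
    g-next zero = trans (count-jump 0<a₁ gap (a-P 1 z<s)) (cong suc count-zero)
      where
      0<a₁ : 0 < a 1
      0<a₁ = n≢0⇒n>0 (λ a₁≡0 → ¬P0 (subst P a₁≡0 (a-P 1 z<s)))
      gap : ∀ {i} → 0 < i → i < a 1 → ¬ P i
      gap _ i<a₁ Pi with _ , 1≤k , k≤0 , _ ← P-below Pi i<a₁ = <⇒≱ 1≤k k≤0
    g-next (suc n) =
      trans (count-jump (a-mono (suc n) (suc (suc n)) z<s (n<1+n (suc n))) gap (a-P (suc (suc n)) z<s))
            (cong suc (g-next n))
      where
      gap : ∀ {i} → a (suc n) < i → i < a (suc (suc n)) → ¬ P i
      gap a[n+1]<i i<a[n+2] Pi with _ , 1≤k , k≤n+1 , ak≡i ← P-below Pi i<a[n+2] =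
        <⇒≱ (a-reflect 1≤k (subst (a (suc n) <_) (sym ak≡i) a[n+1]<i)) k≤n+1

-- Even 2-adic valuation

data EvenOrOdd : ℕ → Set where
  even : ∀ k → EvenOrOdd (2 * k)
  odd  : ∀ k → EvenOrOdd (1 + 2 * k)

evenOrOdd : ∀ n → EvenOrOdd n
evenOrOdd zero = even 0
evenOrOdd (suc n) with evenOrOdd n
... | even k = odd k
... | odd k  = subst EvenOrOdd (cong suc (+-suc k (k + 0))) (even (suc k))

data EvenVal : ℕ → Set where
  odd  : ∀ k → EvenVal (1 + 2 * k)
  quad : ∀ {n} → EvenVal n → EvenVal (4 * n)

evenVal-pos : ∀ {n} → EvenVal n → 0 < n
evenVal-pos (odd k)  = z<s
evenVal-pos (quad e) = *-monoʳ-< 4 (evenVal-pos e)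

4*n≡2*[2*n] : ∀ n → 4 * n ≡ 2 * (2 * n)
4*n≡2*[2*n] = solve-∀

evenVal-quad⁻ : ∀ {n} → EvenVal (4 * n) → EvenVal n
evenVal-quad⁻ {n} e = go e refl
  where
  go : ∀ {m} → EvenVal m → m ≡ 4 * n → EvenVal n
  go (odd k)       eq = contradiction (trans (sym (4*n≡2*[2*n] n)) (sym eq)) (even≢odd (2 * n) k)
  go (quad {n′} e) eq = subst EvenVal (*-cancelˡ-≡ n′ n 4 eq) e

evenVal⇒¬evenVal-double : ∀ {n} → EvenVal n → ¬ EvenVal (2 * n)
evenVal⇒¬evenVal-double (odd k) e = go e refl
  where
  go : ∀ {m} → EvenVal m → m ≢ 2 * (1 + 2 * k)
  go (odd j)      eq = even≢odd (1 + 2 * k) j (sym eq)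
  go (quad {n} _) eq = even≢odd n k (*-cancelˡ-≡ (2 * n) (1 + 2 * k) 2 (trans (sym (4*n≡2*[2*n] n)) eq))
evenVal⇒¬evenVal-double (quad {n} e) e′ =
  evenVal⇒¬evenVal-double e (evenVal-quad⁻ (subst EvenVal (2*[4*n]≡4*[2*n] n) e′))
  where
  2*[4*n]≡4*[2*n] : ∀ n → 2 * (4 * n) ≡ 4 * (2 * n)
  2*[4*n]≡4*[2*n] = solve-∀

evenVal-or-half : ∀ n → 0 < n → EvenVal n ⊎ ∃[ m ] (n ≡ 2 * m × EvenVal m)
evenVal-or-half n = go n (<-wellFounded n)
  where
  go : ∀ n → Acc _<_ n → 0 < n → EvenVal n ⊎ ∃[ m ] (n ≡ 2 * m × EvenVal m)
  go n _ _ with evenOrOdd n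
  go _ _ _  | odd k  = inj₁ (odd k)
  go _ _ () | even zero
  go _ (acc rec) _ | even m@(suc _) with go m (rec (m<m+n m z<s)) z<s
  ... | inj₁ e              = inj₂ (m , refl , e)
  ... | inj₂ (k , m≡2k , e) = inj₁ (subst EvenVal (trans (4*n≡2*[2*n] k) (cong (2 *_) (sym m≡2k))) (quad e))

¬evenVal-0 : ¬ EvenVal 0
¬evenVal-0 e = <-irrefl refl (evenVal-pos e)

evenVal? : ∀ n → Dec (EvenVal n)
evenVal? zero = no ¬evenVal-0
evenVal? (suc n) with evenVal-or-half (suc n) z<s
... | inj₁ e              = yes e
... | inj₂ (m , n≡2m , e) = no λ e′ → evenVal⇒¬evenVal-double e (subst EvenVal n≡2m e′)

evenVal-4q+1 : ∀ q → EvenVal (1 + q * 4)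
evenVal-4q+1 q = subst EvenVal (cong suc (2*[2*q]≡q*4 q)) (odd (2 * q))
  where
  2*[2*q]≡q*4 : ∀ q → 2 * (2 * q) ≡ q * 4
  2*[2*q]≡q*4 = solve-∀

2*[1+2*q]≡2+q*4 : ∀ q → 2 * (1 + 2 * q) ≡ 2 + q * 4
2*[1+2*q]≡2+q*4 = solve-∀

¬evenVal-4q+2 : ∀ q → ¬ EvenVal (2 + q * 4)
¬evenVal-4q+2 q e = evenVal⇒¬evenVal-double (odd q) (subst EvenVal (sym (2*[1+2*q]≡2+q*4 q)) e)

evenVal-4q+3 : ∀ q → EvenVal (3 + q * 4)
evenVal-4q+3 q = subst EvenVal (cong suc (2*[1+2*q]≡2+q*4 q)) (odd (1 + 2 * q))

-- The function f

nearestDiv-cong : ∀ x {m n} → m ≡ n → .{{_ : NonZero m}} .{{_ : NonZero n}} → nearestDiv x m ≡ nearestDiv x n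
nearestDiv-cong x refl = refl

-- Both sides are ⌊(⌊x/4⌋ + c) / 2c⌋.
nearestDiv-quarter : ∀ x c .{{_ : NonZero c}} .{{_ : NonZero (2 * c)}} .{{_ : NonZero (4 * (2 * c))}} →
                     nearestDiv x (4 * (2 * c)) ≡ nearestDiv (x / 4) (2 * c)
nearestDiv-quarter x c = trans lhs (sym rhs)
  where
  instance
    _ : NonZero (2 * (4 * (2 * c)))
    _ = m*n≢0 2 (4 * (2 * c))
    _ : NonZero (2 * (2 * c))
    _ = m*n≢0 2 (2 * c)
  open ≡-Reasoning
  2*x+8*c≡2*[x+c*4] : ∀ x c → 2 * x + 4 * (2 * c) ≡ 2 * (x + c * 4)
  2*x+8*c≡2*[x+c*4] = solve-∀
  quarter : (x + c * 4) / 4 ≡ x / 4 + c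
  quarter = trans (+-distrib-/-∣ʳ x (divides-refl c)) (cong (x / 4 +_) (m*n/n≡m c 4))
  lhs : (2 * x + 4 * (2 * c)) / (2 * (4 * (2 * c))) ≡ (x / 4 + c) / (2 * c)
  lhs = begin
    (2 * x + 4 * (2 * c)) / (2 * (4 * (2 * c))) ≡⟨ /-congˡ {o = 2 * (4 * (2 * c))} (2*x+8*c≡2*[x+c*4] x c) ⟩
    2 * (x + c * 4) / (2 * (4 * (2 * c)))       ≡⟨ m*n/m*o≡n/o 2 (x + c * 4) (4 * (2 * c)) ⟩
    (x + c * 4) / (4 * (2 * c))                 ≡⟨ m/n/o≡m/[n*o] (x + c * 4) 4 (2 * c) ⟨
    (x + c * 4) / 4 / (2 * c)                   ≡⟨ /-congˡ {o = 2 * c} quarter ⟩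
    (x / 4 + c) / (2 * c)                       ∎
  rhs : (2 * (x / 4) + 2 * c) / (2 * (2 * c)) ≡ (x / 4 + c) / (2 * c)
  rhs = trans (/-congˡ {o = 2 * (2 * c)} (sym (*-distribˡ-+ 2 (x / 4) c))) (m*n/m*o≡n/o 2 (x / 4 + c) (2 * c))

term-suc : ∀ x j → term x (suc j) ≡ term (x / 4) j
term-suc x j = begin
  term x (suc j)             ≡⟨ nearestDiv-cong x (2^[2j+3]≡8*c j) ⟩
  nearestDiv x (4 * (2 * c)) ≡⟨ nearestDiv-quarter x c ⟩
  nearestDiv (x / 4) (2 * c) ≡⟨ nearestDiv-cong (x / 4) (cong (2 ^_) (+-comm (2 * j) 1)) ⟨
  term (x / 4) j             ∎
  where
  open ≡-Reasoning
  c : ℕ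
  c = 2 ^ (2 * j)
  instance
    _ : NonZero c
    _ = m^n≢0 2 (2 * j)
    _ : NonZero (2 * c)
    _ = m*n≢0 2 c
    _ : NonZero (4 * (2 * c))
    _ = m*n≢0 4 (2 * c)
    _ : NonZero (2 ^ (2 * suc j + 1))
    _ = m^n≢0 2 (2 * suc j + 1)
    _ : NonZero (2 ^ (2 * j + 1))
    _ = m^n≢0 2 (2 * j + 1)
  2^[2j+3]≡8*c : ∀ j → 2 ^ (2 * suc j + 1) ≡ 4 * (2 * 2 ^ (2 * j))
  2^[2j+3]≡8*c j = trans (cong (2 ^_) (exponent j)) (2*[2*[2*c]]≡4*[2*c] (2 ^ (2 * j)))
    where
    exponent : ∀ j → 2 * suc j + 1 ≡ 3 + 2 * j
    exponent = solve-∀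
    2*[2*[2*c]]≡4*[2*c] : ∀ c → 2 * (2 * (2 * c)) ≡ 4 * (2 * c)
    2*[2*[2*c]]≡4*[2*c] = solve-∀

-- fUpTo N x = Σ_{j<N} term x j, unrolled along term-suc.
fUpTo : ℕ → ℕ → ℕ
fUpTo zero    x = 0
fUpTo (suc N) x = term x 0 + fUpTo N (x / 4)

sum-terms≡fUpTo : ∀ N x (g : ℕ → ℕ) → (∀ j → g j ≡ term x j) → sum (applyUpTo g N) ≡ fUpTo N x
sum-terms≡fUpTo zero    x g g≗term = refl
sum-terms≡fUpTo (suc N) x g g≗term =
  cong₂ _+_ (g≗term 0) (sum-terms≡fUpTo N (x / 4) (λ j → g (suc j)) (λ j → trans (g≗term (suc j)) (term-suc x j)))

f≡fUpTo : ∀ x → f x ≡ fUpTo (suc x) x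
f≡fUpTo x = trans (cong sum (map-upTo (term x) (suc x))) (sum-terms≡fUpTo (suc x) x (term x) (λ _ → refl))

fUpTo-stable : ∀ N x → x < 4 ^ N → fUpTo (suc N) x ≡ fUpTo N x
fUpTo-stable zero    zero    _          = refl
fUpTo-stable zero    (suc x) (s≤s ())
fUpTo-stable (suc N) x       x<4^[N+1] =
  cong (term x 0 +_) (fUpTo-stable N (x / 4) (m<n*o⇒m/o<n (subst (x <_) (*-comm 4 (4 ^ N)) x<4^[N+1])))

fUpTo-digits : ∀ N q r → fUpTo (suc N) (r + q * 4) ≡ (2 * r + 2) / 4 + 2 * q + fUpTo N (r / 4 + q)
fUpTo-digits N q r = cong₂ _+_ first-term (cong (fUpTo N) quotient)
  where
  quotient : (r + q * 4) / 4 ≡ r / 4 + q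
  quotient = trans (+-distrib-/-∣ʳ r (divides-refl q)) (cong (r / 4 +_) (m*n/n≡m q 4))
  2*[r+q*4]+2≡2*r+2+2*q*4 : ∀ r q → 2 * (r + q * 4) + 2 ≡ 2 * r + 2 + 2 * q * 4
  2*[r+q*4]+2≡2*r+2+2*q*4 = solve-∀
  first-term : term (r + q * 4) 0 ≡ (2 * r + 2) / 4 + 2 * q
  first-term = trans (/-congˡ (2*[r+q*4]+2≡2*r+2+2*q*4 r q))
    (trans (+-distrib-/-∣ʳ (2 * r + 2) (divides-refl (2 * q))) (cong ((2 * r + 2) / 4 +_) (m*n/n≡m (2 * q) 4)))

-- Only at x + 1 = 4(q + 1) does ⌊x/4⌋ move, and then the step is the step of fUpTo N at q.
fUpTo-carry : ∀ N q → CountStep EvenVal (fUpTo N) q → CountStep EvenVal (fUpTo (suc N)) (3 + q * 4)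
fUpTo-carry N q (hit , miss) =
  (λ e → trans carried (trans (cong (2 + 2 * q +_) (hit (evenVal-quad⁻ (subst EvenVal [q+1]*4≡4*[q+1] e))))
                              (trans (+-suc (2 + 2 * q) (fUpTo N q)) (cong suc (sym uncarried))))) ,
  (λ ¬e → trans carried (trans (cong (2 + 2 * q +_) (miss (λ e → ¬e (subst EvenVal (sym [q+1]*4≡4*[q+1]) (quad e)))))
                               (sym uncarried)))
  where
  [q+1]*4≡4*[q+1] : suc q * 4 ≡ 4 * suc q
  [q+1]*4≡4*[q+1] = *-comm (suc q) 4
  carried : fUpTo (suc N) (suc q * 4) ≡ 2 + 2 * q + fUpTo N (suc q)
  carried = trans (fUpTo-digits N (suc q) 0) (cong (_+ fUpTo N (suc q)) (*-distribˡ-+ 2 1 q))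
  uncarried : fUpTo (suc N) (3 + q * 4) ≡ 2 + 2 * q + fUpTo N q
  uncarried = fUpTo-digits N q 3

fUpTo-step : ∀ N x → suc x < 4 ^ N → CountStep EvenVal (fUpTo N) x
fUpTo-step zero    x (s≤s ())
fUpTo-step (suc N) x 1+x<4^[N+1] =
  subst (CountStep EvenVal (fUpTo (suc N))) (sym x≡r+q*4)
        (digit-step (x / 4) (x % 4) (m%n<n x 4) (subst (λ y → suc y < 4 ^ suc N) x≡r+q*4 1+x<4^[N+1]))
  where
  x≡r+q*4 : x ≡ x % 4 + x / 4 * 4
  x≡r+q*4 = m≡m%n+[m/n]*n x 4
  digits : ∀ q r → fUpTo (suc N) (r + q * 4) ≡ (2 * r + 2) / 4 + 2 * q + fUpTo N (r / 4 + q)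
  digits = fUpTo-digits N
  digit-step : ∀ q r → r < 4 → suc (r + q * 4) < 4 ^ suc N → CountStep EvenVal (fUpTo (suc N)) (r + q * 4)
  digit-step q 0 _ _ = (λ _ → trans (digits q 1) (cong suc (sym (digits q 0)))) ,
                       (λ ¬e → contradiction (evenVal-4q+1 q) ¬e)
  digit-step q 1 _ _ = (λ e → contradiction e (¬evenVal-4q+2 q)) ,
                       (λ _ → trans (digits q 2) (sym (digits q 1)))
  digit-step q 2 _ _ = (λ _ → trans (digits q 3) (cong suc (sym (digits q 2)))) ,
                       (λ ¬e → contradiction (evenVal-4q+3 q) ¬e)
  digit-step q 3 _ [q+1]*4<4^[N+1] =
    fUpTo-carry N q (fUpTo-step N q (*-cancelˡ-< 4 (suc q) (4 ^ N) (subst (_< 4 ^ suc N) (*-comm (suc q) 4) [q+1]*4<4^[N+1])))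
  digit-step q (suc (suc (suc (suc _)))) (s≤s (s≤s (s≤s (s≤s ())))) _

n<4^n : ∀ n → n < 4 ^ n
n<4^n zero    = z<s
n<4^n (suc n) = ≤-<-trans (n<4^n n) (m<m+n (4 ^ n) (≤-trans (m^n>0 4 n) (m≤m+n (4 ^ n) (2 * 4 ^ n))))

f-counts : Counts EvenVal f
f-counts = record { count-zero = refl ; count-step = f-step }
  where
  f-step : ∀ x → CountStep EvenVal f x
  f-step x = subst₂ (λ u v → (EvenVal (suc x) → u ≡ suc v) × (¬ EvenVal (suc x) → u ≡ v))
                    (sym (f≡fUpTo (suc x))) fUpTo≡f
                    (fUpTo-step (suc (suc x)) x (<-trans (n<1+n (suc x)) (n<4^n (suc (suc x)))))
    where
    fUpTo≡f : fUpTo (suc (suc x)) x ≡ f x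
    fUpTo≡f = trans (fUpTo-stable (suc x) x (<-trans (n<1+n x) (n<4^n (suc x)))) (sym (f≡fUpTo x))

-- The P-positions of Corner the Queen Bee

min≡⊓ : ∀ x y → min x y ≡ x ⊓ y
min≡⊓ zero    y       = refl
min≡⊓ (suc x) zero    = refl
min≡⊓ (suc x) (suc y) = cong suc (min≡⊓ x y)

≤min⇒≤ˡ : ∀ {s x y} → s ≤ min x y → s ≤ x
≤min⇒≤ˡ {s} {x} {y} s≤min = ≤-trans (subst (s ≤_) (min≡⊓ x y) s≤min) (m⊓n≤m x y)

data Move (x y : ℕ) : ℕ × ℕ → Set where
  horizontal : ∀ {x′} → x′ < x → Move x y (x′ , y)
  vertical   : ∀ {y′} → y′ < y → Move x y (x , y′)
  diagonal   : ∀ {s} → 0 < s → s ≤ min x y → Move x y (x ∸ s , y ∸ s)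
  hopˡ       : ∀ {t} → x < y → 0 < t → t < 2 * x → Move x y (t , y ∸ x)
  hopʳ       : ∀ {t} → y < x → 0 < t → t < 2 * y → Move x y (x ∸ y , t)

Move-swap : ∀ {x y x′ y′} → Move x y (x′ , y′) → Move y x (y′ , x′)
Move-swap (horizontal x′<x)         = vertical x′<x
Move-swap (vertical y′<y)           = horizontal y′<y
Move-swap {x} {y} (diagonal 0<s s≤min) =
  diagonal 0<s (subst (_ ≤_) (trans (min≡⊓ x y) (trans (⊓-comm x y) (sym (min≡⊓ y x)))) s≤min)
Move-swap (hopˡ x<y 0<t t<2x)       = hopʳ x<y 0<t t<2x
Move-swap (hopʳ y<x 0<t t<2y)       = hopˡ y<x 0<t t<2y

Move-decreasing : ∀ {x y x′ y′} → Move x y (x′ , y′) → x′ + y′ < x + y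
Move-decreasing {x} {y} (horizontal x′<x) = +-monoˡ-< y x′<x
Move-decreasing {x} {y} (vertical y′<y)   = +-monoʳ-< x y′<y
Move-decreasing {x} {y} (diagonal {s} 0<s s≤min) = +-mono-<-≤ (∸-monoʳ-< 0<s (≤min⇒≤ˡ s≤min)) (m∸n≤m y s)
Move-decreasing {x} {y} (hopˡ {t} x<y _ t<2x) = begin-strict
  t + (y ∸ x)       <⟨ +-monoˡ-< (y ∸ x) t<2x ⟩
  2 * x + (y ∸ x)   ≡⟨ cong (_+ (y ∸ x)) (cong (x +_) (+-identityʳ x)) ⟩
  x + x + (y ∸ x)   ≡⟨ +-assoc x x (y ∸ x) ⟩
  x + (x + (y ∸ x)) ≡⟨ cong (x +_) (m+[n∸m]≡n (<⇒≤ x<y)) ⟩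
  x + y             ∎
  where open ≤-Reasoning
Move-decreasing {x} {y} (hopʳ {t} y<x 0<t t<2y) =
  subst₂ _<_ (+-comm t (x ∸ y)) (+-comm y x) (Move-decreasing (hopˡ {y} {x} y<x 0<t t<2y))

<∸1⇒1+< : ∀ {k n} → k < n ∸ 1 → suc k < n
<∸1⇒1+< {n = suc n} k<n = s≤s k<n

-- moves x y is, by definition, horizontals x y ++ verticals x y ++ diagonals x y ++ hops (x <ᵇ y) (y <ᵇ x) x y;
-- the two comparisons are arguments of hops so that they can be case-split.
horizontals verticals diagonals : ℕ → ℕ → List (ℕ × ℕ)
horizontals x y = map (λ x′ → (x′ , y)) (upTo x)
verticals   x y = map (λ y′ → (x , y′)) (upTo y)
diagonals   x y = map (λ k → (x ∸ suc k , y ∸ suc k)) (upTo (min x y))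

hops : Bool → Bool → ℕ → ℕ → List (ℕ × ℕ)
hops b c x y = if b
  then map (λ k → (suc k , y ∸ x)) (upTo (2 * x ∸ 1))
  else if c
    then map (λ k → (x ∸ y , suc k)) (upTo (2 * y ∸ 1))
    else []

∈-moves⁻ : ∀ {x y p} → p ∈ moves x y → Move x y p
∈-moves⁻ {x} {y} p∈ with ∈-++⁻ (horizontals x y) p∈
... | inj₁ p∈ˡ with _ , x′∈ , refl ← ∈-map⁻ _ p∈ˡ = horizontal (∈-upTo⁻ x′∈)
... | inj₂ p∈ʳ with ∈-++⁻ (verticals x y) p∈ʳ
...   | inj₁ p∈ˡ with _ , y′∈ , refl ← ∈-map⁻ _ p∈ˡ = vertical (∈-upTo⁻ y′∈)
...   | inj₂ p∈ʳ with ∈-++⁻ (diagonals x y) p∈ʳ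
...     | inj₁ p∈ˡ with _ , k∈ , refl ← ∈-map⁻ _ p∈ˡ = diagonal z<s (∈-upTo⁻ k∈)
...     | inj₂ p∈ʳ = ∈-hops⁻ (x <ᵇ y) (y <ᵇ x) refl refl p∈ʳ
  where
  ∈-hops⁻ : ∀ {p} b c → b ≡ (x <ᵇ y) → c ≡ (y <ᵇ x) → p ∈ hops b c x y → Move x y p
  ∈-hops⁻ true  _    b≡ _  p∈ with _ , k∈ , refl ← ∈-map⁻ _ p∈ =
    hopˡ (<ᵇ⇒< x y (subst T b≡ tt)) z<s (<∸1⇒1+< (∈-upTo⁻ k∈))
  ∈-hops⁻ false true _  c≡ p∈ with _ , k∈ , refl ← ∈-map⁻ _ p∈ =
    hopʳ (<ᵇ⇒< y x (subst T c≡ tt)) z<s (<∸1⇒1+< (∈-upTo⁻ k∈))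

∈-moves⁺ : ∀ {x y p} → Move x y p → p ∈ moves x y
∈-moves⁺ {x} {y} (horizontal x′<x) = ∈-++⁺ˡ (∈-map⁺ (λ x′ → (x′ , y)) (∈-upTo⁺ x′<x))
∈-moves⁺ {x} {y} (vertical y′<y) =
  ∈-++⁺ʳ (horizontals x y) (∈-++⁺ˡ (∈-map⁺ (λ y′ → (x , y′)) (∈-upTo⁺ y′<y)))
∈-moves⁺ {x} {y} (diagonal {suc k} _ k<min) =
  ∈-++⁺ʳ (horizontals x y) (∈-++⁺ʳ (verticals x y)
    (∈-++⁺ˡ (∈-map⁺ (λ k → (x ∸ suc k , y ∸ suc k)) (∈-upTo⁺ k<min))))
∈-moves⁺ {x} {y} (hopˡ {suc k} x<y _ 1+k<2x) =
  ∈-++⁺ʳ (horizontals x y) (∈-++⁺ʳ (verticals x y) (∈-++⁺ʳ (diagonals x y) (∈-hops⁺ (x <ᵇ y) refl)))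
  where
  ∈-hops⁺ : ∀ b {c} → b ≡ (x <ᵇ y) → (suc k , y ∸ x) ∈ hops b c x y
  ∈-hops⁺ true  _  = ∈-map⁺ (λ k → (suc k , y ∸ x)) (∈-upTo⁺ (∸-monoˡ-≤ 1 1+k<2x))
  ∈-hops⁺ false b≡ = contradiction (subst T (sym b≡) (<⇒<ᵇ x<y)) λ ()
∈-moves⁺ {x} {y} (hopʳ {suc k} y<x _ 1+k<2y) =
  ∈-++⁺ʳ (horizontals x y) (∈-++⁺ʳ (verticals x y) (∈-++⁺ʳ (diagonals x y) (∈-hops⁺ (x <ᵇ y) (y <ᵇ x) refl refl)))
  where
  ∈-hops⁺ : ∀ b c → b ≡ (x <ᵇ y) → c ≡ (y <ᵇ x) → (x ∸ y , suc k) ∈ hops b c x y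
  ∈-hops⁺ true  _     b≡ _  = contradiction (<ᵇ⇒< x y (subst T b≡ tt)) (<-asym y<x)
  ∈-hops⁺ false true  _  _  = ∈-map⁺ (λ k → (x ∸ y , suc k)) (∈-upTo⁺ (∸-monoˡ-≤ 1 1+k<2y))
  ∈-hops⁺ false false _  c≡ = contradiction (subst T (sym c≡) (<⇒<ᵇ y<x)) λ ()

not-any≡true⇔ : ∀ {A : Set} (q : A → Bool) xs → not (any q xs) ≡ true ⇔ (∀ {a} → a ∈ xs → q a ≢ true)
not-any≡true⇔ q xs = mk⇔ to from
  where
  to : not (any q xs) ≡ true → ∀ {a} → a ∈ xs → q a ≢ true
  to h a∈ qa≡true =
    subst T (Equivalence.to T-not-≡ (Equivalence.from T-≡ h)) (any⁺ q (lose a∈ (Equivalence.from T-≡ qa≡true)))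
  from : (∀ {a} → a ∈ xs → q a ≢ true) → not (any q xs) ≡ true
  from h with any q xs in eq
  ... | false = refl
  ... | true with _ , a∈ , qa ← find (any⁻ q xs (subst T (sym eq) tt)) = contradiction (Equivalence.to T-≡ qa) (h a∈)

module _ (S : ℕ → ℕ → Set) (S? : ∀ x y → Dec (S x y))
         (stable : ∀ {x y x′ y′} → S x y → Move x y (x′ , y′) → ¬ S x′ y′)
         (absorbing : ∀ {x y} → ¬ S x y → ∃[ x′ ] ∃[ y′ ] (Move x y (x′ , y′) × S x′ y′))
         where

  isPFuel⇔ : ∀ k x y → x + y ≤ k → isPFuel k x y ≡ true ⇔ S x y
  isPFuel⇔ zero zero zero _ = mk⇔ (λ _ → origin) (λ _ → refl)
    where
    origin : S 0 0
    origin with S? 0 0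
    ... | yes s = s
    ... | no ¬s with _ , _ , m , _ ← absorbing ¬s = contradiction (Move-decreasing m) λ ()
  isPFuel⇔ (suc k) x y x+y≤1+k = mk⇔ to from
    where
    IH : ∀ {x′ y′} → Move x y (x′ , y′) → isPFuel k x′ y′ ≡ true ⇔ S x′ y′
    IH m = isPFuel⇔ k _ _ (≤-pred (≤-trans (Move-decreasing m) x+y≤1+k))
    open Equivalence (not-any≡true⇔ _ (moves x y)) renaming (to to no-P-move; from to no-P-move⁻¹)
    to : isPFuel (suc k) x y ≡ true → S x y
    to h with S? x y
    ... | yes s = s
    ... | no ¬s with _ , _ , m , s′ ← absorbing ¬s = contradiction (Equivalence.from (IH m) s′) (no-P-move h (∈-moves⁺ m))
    from : S x y → isPFuel (suc k) x y ≡ true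
    from s = no-P-move⁻¹ λ { {x′ , y′} p∈ P′ → stable s (∈-moves⁻ p∈) (Equivalence.to (IH (∈-moves⁻ p∈)) P′) }

  IsP⇔ : ∀ {x y} → IsP x y ⇔ S x y
  IsP⇔ {x} {y} = isPFuel⇔ (x + y) x y ≤-refl

Doubling : ℕ → ℕ → Set
Doubling x y = EvenVal x × y ≡ 2 * x

P-position : ℕ → ℕ → Set
P-position x y = (x ≡ 0 × y ≡ 0) ⊎ Doubling x y ⊎ Doubling y x

P-position? : ∀ x y → Dec (P-position x y)
P-position? x y = (x ≟ 0 ×-dec y ≟ 0) ⊎-dec (evenVal? x ×-dec y ≟ 2 * x) ⊎-dec (evenVal? y ×-dec x ≟ 2 * y)

P-position-swap : ∀ {x y} → P-position x y → P-position y x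
P-position-swap (inj₁ (x≡0 , y≡0)) = inj₁ (y≡0 , x≡0)
P-position-swap (inj₂ (inj₁ d))    = inj₂ (inj₂ d)
P-position-swap (inj₂ (inj₂ d))    = inj₂ (inj₁ d)

n<2*n : ∀ {n} → 0 < n → n < 2 * n
n<2*n {n} 0<n = subst (n <_) (cong (n +_) (sym (+-identityʳ n))) (m<m+n n 0<n)

n≤2*n : ∀ n → n ≤ 2 * n
n≤2*n n = m≤m+n n (n + 0)

2*n∸n≡n : ∀ n → 2 * n ∸ n ≡ n
2*n∸n≡n n = trans (m+n∸m≡n n (n + 0)) (+-identityʳ n)

m<2n⇒m∸n<n : ∀ {m n} → n ≤ m → m < 2 * n → m ∸ n < n
m<2n⇒m∸n<n {m} {n} n≤m m<2n = subst (m ∸ n <_) (2*n∸n≡n n) (∸-monoˡ-< m<2n n≤m)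

¬P-position-below : ∀ {a y′} → EvenVal a → y′ < 2 * a → ¬ P-position a y′
¬P-position-below ea y′<2a (inj₁ (a≡0 , _))           = <⇒≢ (evenVal-pos ea) (sym a≡0)
¬P-position-below ea y′<2a (inj₂ (inj₁ (_ , y′≡2a)))   = <-irrefl y′≡2a y′<2a
¬P-position-below ea y′<2a (inj₂ (inj₂ (ey′ , a≡2y′))) = evenVal⇒¬evenVal-double ey′ (subst EvenVal a≡2y′ ea)

Doubling-stable : ∀ {a x′ y′} → EvenVal a → Move a (2 * a) (x′ , y′) → ¬ P-position x′ y′
Doubling-stable {a} ea = stable
  where
  0<a : 0 < a
  0<a = evenVal-pos ea
  a<2a : a < 2 * a
  a<2a = n<2*n 0<a
  ¬P-position-diagonal : ∀ {u} → u < a → ¬ P-position u (a + u)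
  ¬P-position-diagonal u<a (inj₁ (_ , a+u≡0))           = <⇒≢ 0<a (sym (m+n≡0⇒m≡0 a a+u≡0))
  ¬P-position-diagonal {u} u<a (inj₂ (inj₁ (_ , a+u≡2u))) =
    <-irrefl (sym (+-cancelʳ-≡ u a u (trans a+u≡2u (cong (u +_) (+-identityʳ u))))) u<a
  ¬P-position-diagonal {u} u<a (inj₂ (inj₂ (_ , u≡2[a+u]))) =
    <⇒≱ u<a (≤-trans (m≤m+n a u) (≤-trans (n≤2*n (a + u)) (≤-reflexive (sym u≡2[a+u]))))
  stable : ∀ {x′ y′} → Move a (2 * a) (x′ , y′) → ¬ P-position x′ y′
  stable (horizontal x′<a) (inj₁ (_ , 2a≡0))         = <⇒≢ (<-trans 0<a a<2a) (sym 2a≡0)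
  stable (horizontal x′<a) (inj₂ (inj₁ (_ , 2a≡2x′))) = <-irrefl (sym (*-cancelˡ-≡ a _ 2 2a≡2x′)) x′<a
  stable (horizontal x′<a) (inj₂ (inj₂ (_ , x′≡4a)))  =
    <⇒≱ x′<a (≤-trans (n≤2*n a) (≤-trans (n≤2*n (2 * a)) (≤-reflexive (sym x′≡4a))))
  stable (vertical y′<2a) = ¬P-position-below ea y′<2a
  stable (diagonal {s} 0<s s≤min) P′ =
    ¬P-position-diagonal (∸-monoʳ-< 0<s s≤a) (subst (P-position (a ∸ s)) 2a∸s≡a+[a∸s] P′)
    where
    s≤a : s ≤ a
    s≤a = ≤min⇒≤ˡ s≤min
    2a∸s≡a+[a∸s] : 2 * a ∸ s ≡ a + (a ∸ s)
    2a∸s≡a+[a∸s] = trans (cong (λ z → a + z ∸ s) (+-identityʳ a)) (+-∸-assoc a s≤a)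
  stable (hopˡ _ 0<t t<2a) P′ =
    ¬P-position-below ea t<2a (P-position-swap (subst (P-position _) (2*n∸n≡n a) P′))
  stable (hopʳ 2a<a _ _) = contradiction 2a<a (<-asym a<2a)

P-position-stable : ∀ {x y x′ y′} → P-position x y → Move x y (x′ , y′) → ¬ P-position x′ y′
P-position-stable (inj₁ (refl , refl)) m       = contradiction (Move-decreasing m) λ ()
P-position-stable (inj₂ (inj₁ (ea , refl))) m   = Doubling-stable ea m
P-position-stable (inj₂ (inj₂ (ea , refl))) m P′ = Doubling-stable ea (Move-swap m) (P-position-swap P′)

P-reachable : ℕ → ℕ → Set
P-reachable x y = ∃[ x′ ] ∃[ y′ ] (Move x y (x′ , y′) × P-position x′ y′)

P-reachable-< : ∀ {x y} → 0 < x → x < y → ¬ P-position x y → P-reachable x y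
P-reachable-< {x} {y} 0<x x<y ¬P with evenVal-or-half x 0<x
... | inj₂ (c , x≡2c , ec) = x , c , vertical c<y , inj₂ (inj₂ (ec , x≡2c))
  where
  c<y : c < y
  c<y = <-trans (subst (c <_) (sym x≡2c) (n<2*n (evenVal-pos ec))) x<y
... | inj₁ ex with <-cmp y (2 * x)
...   | tri≈ _ y≡2x _ = contradiction (inj₂ (inj₁ (ex , y≡2x))) ¬P
...   | tri> _ _ 2x<y = x , 2 * x , vertical 2x<y , inj₂ (inj₁ (ex , refl))
...   | tri< y<2x _ _ with evenVal-or-half (y ∸ x) (m<n⇒0<n∸m x<y)
...     | inj₁ ed =
  2 * (y ∸ x) , y ∸ x , hopˡ x<y (*-monoʳ-< 2 (evenVal-pos ed)) (*-monoʳ-< 2 (m<2n⇒m∸n<n (<⇒≤ x<y) y<2x)) ,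
  inj₂ (inj₂ (ed , refl))
...     | inj₂ (c , d≡2c , ec) =
  c , y ∸ x , hopˡ x<y (evenVal-pos ec) c<2x , inj₂ (inj₁ (ec , d≡2c))
  where
  c<2x : c < 2 * x
  c<2x = ≤-<-trans (subst (c ≤_) (sym d≡2c) (n≤2*n c)) (<-trans (m<2n⇒m∸n<n (<⇒≤ x<y) y<2x) (n<2*n 0<x))

P-reachable-≤ : ∀ {x y} → x ≤ y → ¬ P-position x y → P-reachable x y
P-reachable-≤ {zero}  {zero}  _ ¬P = contradiction (inj₁ (refl , refl)) ¬P
P-reachable-≤ {zero}  {suc y} _ _  = 0 , 0 , vertical z<s , inj₁ (refl , refl)
P-reachable-≤ {suc x} {y} 1+x≤y ¬P with m≤n⇒m<n∨m≡n 1+x≤y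
... | inj₁ 1+x<y = P-reachable-< z<s 1+x<y ¬P
... | inj₂ refl  = _ , _ , diagonal z<s (s≤s (≤-reflexive (sym min-idem))) , inj₁ (n∸n≡0 x , n∸n≡0 x)
  where
  min-idem : min x x ≡ x
  min-idem = trans (min≡⊓ x x) (⊓-idem x)

P-reachable-absorbing : ∀ {x y} → ¬ P-position x y → P-reachable x y
P-reachable-absorbing {x} {y} ¬P with ≤-total x y
... | inj₁ x≤y = P-reachable-≤ x≤y ¬P
... | inj₂ y≤x with x′ , y′ , m , P′ ← P-reachable-≤ y≤x (λ P → ¬P (P-position-swap P)) =
  y′ , x′ , Move-swap m , P-position-swap P′

IsP⇔P-position : ∀ {x y} → IsP x y ⇔ P-position x y
IsP⇔P-position = IsP⇔ P-position P-position? P-position-stable P-reachable-absorbing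

evenVal⇒IsP : ∀ {x} → EvenVal x → IsP x (2 * x)
evenVal⇒IsP ex = Equivalence.from IsP⇔P-position (inj₂ (inj₁ (ex , refl)))

P-position⇒evenVal : ∀ {x y} → P-position x y → 0 < x → x ≤ y → EvenVal x
P-position⇒evenVal (inj₁ (x≡0 , _))         0<x _   = contradiction (sym x≡0) (<⇒≢ 0<x)
P-position⇒evenVal (inj₂ (inj₁ (ex , _)))   _   _   = ex
P-position⇒evenVal (inj₂ (inj₂ (ey , refl))) _  2y≤y = contradiction 2y≤y (<⇒≱ (n<2*n (evenVal-pos ey)))

proposition1 : (a b : ℕ → ℕ)
    → (∀ m n → 1 ≤ m → m < n → a m < a n)
    → (∀ n → 1 ≤ n → IsP (a n) (b n) × 0 < a n × a n ≤ b n)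
    → (∀ x y → IsP x y → 0 < x → x ≤ y → ∃[ n ] (1 ≤ n × a n ≡ x × b n ≡ y))
    → ∀ n → 1 ≤ n → f (a n) ≡ n
proposition1 a b a-mono a-P P-a = count-enumeration f-counts a a-mono a-evenVal evenVal-a ¬evenVal-0
  where
  a-evenVal : ∀ n → 1 ≤ n → EvenVal (a n)
  a-evenVal n 1≤n with IsP-ab , 0<a , a≤b ← a-P n 1≤n =
    P-position⇒evenVal (Equivalence.to IsP⇔P-position IsP-ab) 0<a a≤b
  evenVal-a : ∀ x → EvenVal x → ∃[ n ] (1 ≤ n × a n ≡ x)
  evenVal-a x ex with n , 1≤n , an≡x , _ ← P-a x (2 * x) (evenVal⇒IsP ex) (evenVal-pos ex) (n≤2*n x) = n , 1≤n , an≡x
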